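{- Let $a_1,\dots,a_n \geq 1$ be integers and let $R_1,\dots,R_n\subseteq\mathbb{Z}$ be intervals of integers. For $i=1,\dots,n$ let $S_i$ be the set of all integers $s\geq 0$ such that for every $j \in \{i,i+1,\dots,n\}$ there exists $r_j\in R_j$ with $s\equiv r_j \pmod{a_j}$, and let $S_{n+1} = \mathbb{Z}_{\geq 0}$. Then $S_i^{[a_i]} = R_i^{[a_i]} \cap S_{i+1}^{[a_i]}$ for all $i=1,\dots,n$.
   Context: For an integer $\alpha\ge 1$ and a set $X\subseteq\mathbb{Z}$, $X^{[\alpha]} = \{z \bmod \alpha : z \in X\}\subseteq[0,\alpha)$. -}

module Defs where

open import Level using (0ℓ)
open import Data.Nat as ℕ using (ℕ; NonZero; suc)
open import Data.Fin using (Fin; toℕ)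
open import Data.Integer as ℤ using (ℤ; +_; _-_)
open import Data.Integer.DivMod using (_%ℕ_)
open import Data.Integer.Divisibility using (_∣_)
open import Data.Product using (∃; _×_)
open import Relation.Unary using (Pred)

IsInterval : Pred ℤ 0ℓ → Set
IsInterval R = ∀ x y z → R x → R z → x ℤ.≤ y → y ℤ.≤ z → R y

_≡_[mod_] : ℤ → ℤ → ℕ → Set
s ≡ r [mod a ] = (+ a) ∣ (s - r)

-- X^[α] = { z mod α : z ∈ X } ⊆ [0, α), as a predicate on ℕ
Res : (α : ℕ) → .{{NonZero α}} → Pred ℤ 0ℓ → Pred ℕ 0ℓ
Res α X t = ∃ λ z → X z × (z %ℕ α ≡ t)
  where open import Relation.Binary.PropositionalEquality using (_≡_)

-- S_{i+1} (0-based index i, i = 0..n): integers s ≥ 0 such that for every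
-- j with i ≤ j < n there is r_j ∈ R_j with s ≡ r_j (mod a_j).
-- For i = n this is ℤ_{≥0}, i.e. S_{n+1}.
S : (n : ℕ) → (a : Fin n → ℕ) → (R : Fin n → Pred ℤ 0ℓ) → ℕ → Pred ℤ 0ℓ
S n a R i s = (+ 0 ℤ.≤ s) × (∀ (j : Fin n) → i ℕ.≤ toℕ j → ∃ λ r → R j r × (s ≡ r [mod a j ]))

-- An element s of S_{i+1} lies in S_i exactly when s is congruent mod a_i to some
-- element of R_i, i.e. S_i = S_{i+1} ∩ (R_i + a_iℤ). For any sets X, Y, the residues
-- mod α of X ∩ (Y + αℤ) are exactly X^[α] ∩ Y^[α]: a common residue t = x mod α = y mod α
-- makes x itself congruent to y.
module Submission where

open import Defs
open import Level using (0ℓ)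
open import Data.Nat using (ℕ; suc; _≤_; >-nonZero)
open import Data.Fin using (Fin; toℕ)
open import Data.Integer using (ℤ)
open import Data.Product using (_×_)
open import Relation.Unary using (Pred)
open import Function.Bundles using (_⇔_)

open import Data.Nat as ℕ using (NonZero)
import Data.Nat.Properties as ℕ
import Data.Nat.Divisibility as ℕ
open import Data.Integer as ℤ using (+_; _-_; ∣_∣)
import Data.Integer.Properties as ℤ
open import Data.Integer.DivMod using (_%ℕ_; _/ℕ_; a≡a%ℕn+[a/ℕn]*n; n%ℕd<d)
open import Data.Integer.Divisibility using (_∣_)
import Data.Integer.Divisibility.Signed as Signed
open import Data.Integer.Tactic.RingSolver using (solve-∀)
open import Data.Fin.Properties using (toℕ-injective)
open import Data.Product using (_,_; ∃)
open import Data.Sum using (inj₁; inj₂)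
open import Function.Bundles using (mk⇔)
import Function.Properties.Equivalence as ⇔
open import Relation.Binary.PropositionalEquality
open import Relation.Nullary using (contradiction)
open import Relation.Unary using (_⊆_; _≐_; _∩_)

private
  variable
    a : ℕ

≡[mod]-sym : ∀ x y → x ≡ y [mod a ] → y ≡ x [mod a ]
≡[mod]-sym x y = subst (ℕ._∣_ _) (ℤ.∣i-j∣≡∣j-i∣ x y)

≡[mod]-trans : ∀ x y z → x ≡ y [mod a ] → y ≡ z [mod a ] → x ≡ z [mod a ]
≡[mod]-trans {a} x y z p q = Signed.∣⇒∣ᵤ (subst (Signed._∣_ _) (telescope x y z)
  (Signed.∣m∣n⇒∣m+n (Signed.∣ᵤ⇒∣ {+ a} {x - y} p) (Signed.∣ᵤ⇒∣ {+ a} {y - z} q)))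
  where
  telescope : ∀ x y z → (x - y) ℤ.+ (y - z) ≡ x - z
  telescope = solve-∀

≡[mod]-%ℕ : ∀ z a .{{_ : NonZero a}} → z ≡ (+ (z %ℕ a)) [mod a ]
≡[mod]-%ℕ z a = Signed.∣⇒∣ᵤ (Signed.divides (z /ℕ a) (begin
  z - + r                      ≡⟨ cong (_- + r) (a≡a%ℕn+[a/ℕn]*n z a) ⟩
  + r ℤ.+ z /ℕ a ℤ.* + a - + r ≡⟨ cancel (+ r) (z /ℕ a) (+ a) ⟩
  z /ℕ a ℤ.* + a               ∎))
  where
  open ≡-Reasoning
  r = z %ℕ a
  cancel : ∀ r q a → r ℤ.+ q ℤ.* a - r ≡ q ℤ.* a
  cancel = solve-∀

∣i∣<a∧a∣i⇒i≡0 : ∀ {i} → ∣ i ∣ ℕ.< a → + a ∣ i → i ≡ + 0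
∣i∣<a∧a∣i⇒i≡0 {a} {i} ∣i∣<a a∣i with ∣ i ∣ in ∣i∣≡
... | 0     = ℤ.∣i∣≡0⇒i≡0 ∣i∣≡
... | suc _ = contradiction a∣i (ℕ.>⇒∤ ∣i∣<a)

<-≡[mod]⇒≡ : ∀ {m n} → m ℕ.< a → n ℕ.< a → (+ m) ≡ (+ n) [mod a ] → m ≡ n
<-≡[mod]⇒≡ {a} {m} {n} m<a n<a m≡n = ℤ.+-injective (ℤ.i-j≡0⇒i≡j (+ m) (+ n)
  (∣i∣<a∧a∣i⇒i≡0 ∣m-n∣<a m≡n))
  where
  ∣m-n∣<a : ∣ + m - + n ∣ ℕ.< a
  ∣m-n∣<a rewrite ℤ.m-n≡m⊖n m n =
    ℕ.≤-<-trans (ℤ.∣m⊝n∣≤m⊔n m n) (ℕ.⊔-lub m<a n<a)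

%ℕ-≡⇒≡[mod] : ∀ x y .{{_ : NonZero a}} → x %ℕ a ≡ y %ℕ a → x ≡ y [mod a ]
%ℕ-≡⇒≡[mod] {a} x y eq = ≡[mod]-trans x (+ (x %ℕ a)) y (≡[mod]-%ℕ x a)
  (subst (λ r → (+ r) ≡ y [mod a ]) (sym eq) (≡[mod]-sym y _ (≡[mod]-%ℕ y a)))

≡[mod]⇒%ℕ-≡ : ∀ x y .{{_ : NonZero a}} → x ≡ y [mod a ] → x %ℕ a ≡ y %ℕ a
≡[mod]⇒%ℕ-≡ {a} x y x≡y = <-≡[mod]⇒≡ (n%ℕd<d x a) (n%ℕd<d y a)
  (≡[mod]-trans (+ (x %ℕ a)) x (+ (y %ℕ a)) (≡[mod]-sym x _ (≡[mod]-%ℕ x a))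
    (≡[mod]-trans x y (+ (y %ℕ a)) x≡y (≡[mod]-%ℕ y a)))

CongruentTo : ℕ → Pred ℤ 0ℓ → Pred ℤ 0ℓ
CongruentTo a Y s = ∃ λ r → Y r × s ≡ r [mod a ]

Res-mono : ∀ α .{{_ : NonZero α}} {X Y : Pred ℤ 0ℓ} → X ⊆ Y → Res α X ⊆ Res α Y
Res-mono α X⊆Y (z , Xz , z%α≡t) = z , X⊆Y Xz , z%α≡t

Res-cong : ∀ α .{{_ : NonZero α}} {X Y : Pred ℤ 0ℓ} → X ≐ Y → ∀ t → Res α X t ⇔ Res α Y t
Res-cong α (X⊆Y , Y⊆X) t = mk⇔ (Res-mono α X⊆Y) (Res-mono α Y⊆X)

Res-∩-CongruentTo : ∀ α .{{_ : NonZero α}} (X Y : Pred ℤ 0ℓ) t →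
                    Res α (X ∩ CongruentTo α Y) t ⇔ (Res α Y t × Res α X t)
Res-∩-CongruentTo α X Y t = mk⇔ to from
  where
  to : Res α (X ∩ CongruentTo α Y) t → Res α Y t × Res α X t
  to (x , (Xx , y , Yy , x≡y) , x%α≡t) =
    (y , Yy , trans (sym (≡[mod]⇒%ℕ-≡ x y x≡y)) x%α≡t) , (x , Xx , x%α≡t)
  from : Res α Y t × Res α X t → Res α (X ∩ CongruentTo α Y) t
  from ((y , Yy , y%α≡t) , (x , Xx , x%α≡t)) =
    x , (Xx , y , Yy , %ℕ-≡⇒≡[mod] x y (trans x%α≡t (sym y%α≡t))) , x%α≡t

S-step : ∀ n a R (i : Fin n) →
         S n a R (toℕ i) ≐ (S n a R (suc (toℕ i)) ∩ CongruentTo (a i) (R i))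
S-step n a R i = (λ (s≥0 , congs) → (s≥0 , λ j i<j → congs j (ℕ.<⇒≤ i<j)) , congs i ℕ.≤-refl)
               , λ {s} ((s≥0 , congs) , congᵢ) → s≥0 , extend s congs congᵢ
  where
  extend : ∀ s → (∀ j → toℕ i ℕ.< toℕ j → CongruentTo (a j) (R j) s) →
           CongruentTo (a i) (R i) s → ∀ j → toℕ i ≤ toℕ j → CongruentTo (a j) (R j) s
  extend s congs congᵢ j i≤j with ℕ.m≤n⇒m<n∨m≡n i≤j
  ... | inj₁ i<j = congs j i<j
  ... | inj₂ i≡j with refl ← toℕ-injective i≡j = congᵢ

lemma6 : (n : ℕ) (a : Fin n → ℕ) (ha : ∀ i → 1 ≤ a i)
         (R : Fin n → Pred ℤ 0ℓ) → (∀ i → IsInterval (R i)) →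
         ∀ (i : Fin n) (t : ℕ) →
         Res (a i) {{>-nonZero (ha i)}} (S n a R (toℕ i)) t
           ⇔ (Res (a i) {{>-nonZero (ha i)}} (R i) t
              × Res (a i) {{>-nonZero (ha i)}} (S n a R (suc (toℕ i))) t)
lemma6 n a ha R _ i t = ⇔.trans (Res-cong (a i) (S-step n a R i) t)
                                (Res-∩-CongruentTo (a i) _ (R i) t)
  where
  instance
    a≢0 : NonZero (a i)
    a≢0 = >-nonZero (ha i)
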